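{- Let $m\ge 1$ be an integer and $q$ a real number with $q\neq 1$ and $q\ne 0$. Let $G$ be a planar graph and $e$ an edge of $G$ with $P_{G-e}(q)\neq 0$. Then \[ r\big(w_q(S^{2m}(G,e))\big) = \frac{1}{q} + \frac{r(w_q(G,e)) - \frac{1}{q}}{(q-1)^{2m}}. \]
   Context: $P_G(x)$ is the chromatic polynomial (parallel edges do not affect it); $w_q(G,e)\coloneqq\binom{P_{G/e}(q)}{P_{G-e}(q)}$ for an edge $e$ of a planar graph $G$ ($G/e$ contraction, $G-e$ deletion). For $v=\binom{x}{y}$ with $y\ne0$, $r(v)\coloneqq x/y$. Operation $S$ on a pair $(G,e)$ with $e=ab$: $S(G,e)\coloneqq(G',aw)$ where $G'$ is obtained by subdividing $e$ with a new vertex $w$ (replacing $e$ by the path $a-w-b$). $S^{2m}$ denotes applying $S$ successively $2m$ times. -}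

module Defs where

open import Level using (Level; _⊔_) renaming (suc to lsuc)
open import Algebra.Bundles using (CommutativeRing)
open import Data.Bool using (Bool; true; false; not; _∧_; _∨_; if_then_else_)
open import Data.Nat using (ℕ; zero; suc; _≤ᵇ_; _!; _/_) renaming (_+_ to _+ℕ_; _*_ to _*ℕ_)
open import Data.Nat.Properties using (_!≢0)
import Data.Fin
open import Data.Fin using (Fin; toℕ; fromℕ; inject₁; punchOut)
open import Data.Fin.Properties using (_≟_)
open import Data.List using (List; []; _∷_; map; length; concatMap; lookup; removeAt; upTo)
open import Data.Bool.ListAction using (all; any)
open import Data.List.Base using (allFin)
open import Data.Product using (Σ; Σ-syntax; _×_; _,_; proj₁; proj₂)
open import Function using (_∘_)
open import Relation.Binary.PropositionalEquality using (_≡_; _≢_; sym)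
open import Relation.Nullary using (¬_; yes; no; does)

-- The inverse is a
-- total operation; its value at 0# is unspecified and never used.

record Field c ℓ : Set (lsuc (c ⊔ ℓ)) where
  field
    commutativeRing : CommutativeRing c ℓ
  open CommutativeRing commutativeRing public
  infix 8 _⁻¹
  field
    _⁻¹        : Carrier → Carrier
    0≉1        : ¬ (0# ≈ 1#)
    ⁻¹-inverse : ∀ x → ¬ (x ≈ 0#) → x * (x ⁻¹) ≈ 1#

-- Finite (multi)graphs: vertices Fin nV, an edge list of ordered pairs
-- (read as undirected edges; parallel edges and loops allowed).
-- Edges are identified by their position in the list.

record Graph : Set where
  constructor graph
  field
    nV    : ℕ
    edges : List (Fin nV × Fin nV)
open Graph public

Edge : Graph → Set
Edge G = Fin (length (edges G))

_-ₑ_ : (G : Graph) → Edge G → Graph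
G -ₑ e = graph (nV G) (removeAt (edges G) e)

-- identify vertex b with vertex a (a ≢ b); vertices other than b keep
-- their relative order
merge : ∀ {n} (a b : Fin (suc n)) → a ≢ b → Fin (suc n) → Fin n
merge a b a≢b v with v ≟ b
... | yes _  = punchOut {i = b} {j = a} (a≢b ∘ sym)
... | no v≢b = punchOut {i = b} {j = v} (v≢b ∘ sym)

contractAt : ∀ n → Fin n → Fin n → List (Fin n × Fin n) → Graph
contractAt (suc n) a b es with a ≟ b
... | yes _   = graph (suc n) es
... | no a≢b  = graph n (map (λ p → merge a b a≢b (proj₁ p) , merge a b a≢b (proj₂ p)) es)

-- contraction G / e (contracting a loop = deleting it)
_/ₑ_ : (G : Graph) → Edge G → Graph
G /ₑ e = contractAt (nV G) (proj₁ (lookup (edges G) e)) (proj₂ (lookup (edges G) e))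
                    (removeAt (edges G) e)

-- Operation S: subdivide e = ab by a new vertex w; result edge aw.

S : Σ Graph Edge → Σ Graph Edge
S (graph n es , e) =
  graph (suc n) ((a′ , w) ∷ (w , b′) ∷ map (λ p → inject₁ (proj₁ p) , inject₁ (proj₂ p)) (removeAt es e))
  , Data.Fin.zero
  where
  w  = fromℕ n
  a′ = inject₁ (proj₁ (lookup es e))
  b′ = inject₁ (proj₂ (lookup es e))

iterate : ∀ {A : Set} → (A → A) → ℕ → A → A
iterate f zero    x = x
iterate f (suc k) x = f (iterate f k x)

-- Chromatic polynomial.
-- a_k(G) = number of partitions of V(G) into k nonempty independent sets
--        = (number of proper colourings V → Fin k using all k colours) / k!
-- P_G(x) = Σ_{k=0}^{nV} a_k(G) · x(x-1)⋯(x-k+1)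
-- (so P_G(k) = number of proper k-colourings for every k ∈ ℕ).

countTrue : ∀ {A : Set} → (A → Bool) → List A → ℕ
countTrue p []       = zero
countTrue p (x ∷ xs) = (if p x then 1 else 0) +ℕ countTrue p xs

_==_ : ∀ {n} → Fin n → Fin n → Bool
i == j = does (i ≟ j)

allMaps : ∀ n k → List (Fin n → Fin k)
allMaps zero    k = (λ ()) ∷ []
allMaps (suc n) k =
  concatMap (λ c → map (λ f → λ { Data.Fin.zero → c ; (Data.Fin.suc i) → f i }) (allMaps n k)) (allFin k)

isProper : (G : Graph) → ∀ {k} → (Fin (nV G) → Fin k) → Bool
isProper G c = all (λ p → not (c (proj₁ p) == c (proj₂ p))) (edges G)

isOnto : ∀ {n k} → (Fin n → Fin k) → Bool
isOnto {n} {k} c = all (λ j → any (λ i → c i == j) (allFin n)) (allFin k)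

surjColourings : Graph → ℕ → ℕ
surjColourings G k =
  countTrue (λ c → isProper G c ∧ isOnto c) (allMaps (nV G) k)

partitionsInto : Graph → ℕ → ℕ
partitionsInto G k = _/_ (surjColourings G k) (k !) {{k !≢0}}

module _ {c ℓ} (F : Field c ℓ) where
  open Field F using (Carrier; 0#; 1#; _+_; _*_; _-_; _⁻¹)

  ℕ→F : ℕ → Carrier
  ℕ→F zero    = 0#
  ℕ→F (suc n) = 1# + ℕ→F n

  pow : Carrier → ℕ → Carrier
  pow x zero    = 1#
  pow x (suc n) = x * pow x n

  falling : Carrier → ℕ → Carrier
  falling x zero    = 1#
  falling x (suc k) = falling x k * (x - ℕ→F k)

  sumTo : ℕ → (ℕ → Carrier) → Carrier
  sumTo zero    f = f zero
  sumTo (suc N) f = sumTo N f + f (suc N)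

  chromatic : Graph → Carrier → Carrier
  chromatic G x = sumTo (nV G) (λ k → ℕ→F (partitionsInto G k) * falling x k)

  w : Carrier → Σ Graph Edge → Carrier × Carrier
  w q (G , e) = chromatic (G /ₑ e) q , chromatic (G -ₑ e) q

  r : Carrier × Carrier → Carrier
  r (x , y) = x * (y ⁻¹)

-- Planarity, combinatorially: G is planar iff it has a rotation system
-- (combinatorial embedding) of genus 0 on every component, i.e. for which
-- Euler's formula  V - E + F = 2·(#components) - (#isolated vertices) holds.
-- (Darts: (j , false) sits at the first endpoint of edge j, (j , true) at
-- the second.  Faces = orbits of φ = σ ∘ α, α the dart involution.)

Dart : Graph → Set
Dart G = Edge G × Bool

dartVertex : (G : Graph) → Dart G → Fin (nV G)
dartVertex G (j , false) = proj₁ (lookup (edges G) j)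
dartVertex G (j , true)  = proj₂ (lookup (edges G) j)

flipD : ∀ {G} → Dart G → Dart G
flipD (j , b) = j , not b

dartKey : ∀ {G} → Dart G → ℕ
dartKey (j , b) = toℕ j +ℕ toℕ j +ℕ (if b then 1 else 0)

allDarts : (G : Graph) → List (Dart G)
allDarts G = concatMap (λ j → (j , false) ∷ (j , true) ∷ []) (allFin (length (edges G)))

record IsRotationSystem (G : Graph) (σ : Dart G → Dart G) : Set where
  field
    injective  : ∀ d d′ → σ d ≡ σ d′ → d ≡ d′
    atVertex   : ∀ d → dartVertex G (σ d) ≡ dartVertex G d
    cyclic     : ∀ d d′ → dartVertex G d ≡ dartVertex G d′ → Σ[ t ∈ ℕ ] iterate σ t d ≡ d′

-- number of faces: orbits of φ, counted by their key-minimal dart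
faces : (G : Graph) → (Dart G → Dart G) → ℕ
faces G σ = countTrue isLeader (allDarts G)
  where
  φ = λ d → σ (flipD {G} d)
  isLeader : Dart G → Bool
  isLeader d = all (λ t → dartKey {G} d ≤ᵇ dartKey {G} (iterate φ t d)) (upTo (length (allDarts G)))

reach : (G : Graph) → Fin (nV G) → Fin (nV G) → Bool
reach G u = iterate step (nV G) (λ v → u == v)
  where
  step : (Fin (nV G) → Bool) → Fin (nV G) → Bool
  step R v = R v ∨ any (λ p → (R (proj₁ p) ∧ (proj₂ p == v)) ∨ (R (proj₂ p) ∧ (proj₁ p == v))) (edges G)

components : Graph → ℕ
components G = countTrue isLeast (allFin (nV G))
  where
  isLeast : Fin (nV G) → Bool
  isLeast v = all (λ u → not (reach G u v) ∨ (toℕ v ≤ᵇ toℕ u)) (allFin (nV G))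

isolated : Graph → ℕ
isolated G = countTrue (λ v → not (any (λ p → (proj₁ p == v) ∨ (proj₂ p == v)) (edges G))) (allFin (nV G))

Planar : Graph → Set
Planar G = Σ[ σ ∈ (Dart G → Dart G) ]
  (IsRotationSystem G σ × (nV G +ℕ faces G σ +ℕ isolated G ≡ length (edges G) +ℕ 2 *ℕ components G))

module Submission where

open import Defs
open import Algebra.Bundles using (CommutativeRing; RawRing)
open import Data.Nat using (ℕ; _≤_) renaming (_*_ to _*ℕ_)
open import Data.Product using (_×_; _,_; proj₂)
open import Relation.Nullary using (¬_)

-- For p = (G , e) write D p = P_{G−e}(q) and C p = P_{G/e}(q).  In S p = (G′ , aw) the graph
-- G′ − aw is G − e with a pendant edge wb attached, and contracting aw in G′ gives G back, so
-- D (S p) = (q − 1) D p and, by deletion–contraction, C (S p) = D p − C p.  Thus each step of S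
-- multiplies D by q − 1 and changes the sign of q C − D; after 2m steps this is the claimed
-- formula for r = C / D.
--
-- Both rules for P are derived from its definition P_G(x) = Σₖ aₖ(G) (x)ₖ with aₖ(G) = sₖ(G) / k!,
-- where sₖ(G) counts the proper colourings of G onto k colours.  Explicit bijections give
-- sₖ(G − e) = sₖ(G) + sₖ(G / e) and sₖ₊₁(G + pendant) = k sₖ₊₁(G) + (k + 1) sₖ(G); by induction
-- k! divides sₖ(G), so aₖ obeys the same deletion–contraction rule and aₖ₊₁(G + pendant) =
-- k aₖ₊₁(G) + aₖ(G), which telescopes against (x)ₖ₊₁ = (x)ₖ (x − k) to (x − 1) P_G(x).

-- The standard library's ring solver needs coefficients with a usable equality test.  Pairs
-- (a , b) of naturals, read as a − b and kept normalised (one entry is 0), map into any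
-- commutative ring; (a , 0) is sent to a × 1#, so that the constant (1 , 0) is 1# itself.
module DifferenceSolver {c ℓ} (R : CommutativeRing c ℓ) where

  open import Data.Nat as ℕ using (ℕ; zero; suc; _∸_)
  import Data.Nat.Properties as ℕ
  open import Data.Product using (_×_; _,_)
  open import Data.Maybe using (Maybe; just; nothing)
  open import Relation.Binary.PropositionalEquality as ≡ using (_≡_)
  open import Relation.Nullary using (yes; no)
  import Algebra.Solver.Ring
  import Algebra.Solver.Ring.AlmostCommutativeRing as ACR
  open CommutativeRing R
  open import Algebra.Properties.Ring ring using (-‿+-comm; -‿involutive; -‿distribˡ-*; -‿distribʳ-*; -0#≈0#)
  open import Algebra.Properties.Semiring.Mult.TCOptimised semiring using (×-homo-+; ×1-homo-*; 1+×)
    renaming (_×_ to _·_)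
  open import Algebra.Properties.CommutativeSemigroup +-commutativeSemigroup using (interchange)
  open import Relation.Binary.Reasoning.Setoid setoid

  ι : ℕ → Carrier
  ι n = n · 1#

  ι-homo-+ : ∀ a b → ι (a ℕ.+ b) ≈ ι a + ι b
  ι-homo-+ = ×-homo-+ 1#

  ι-homo-* : ∀ a b → ι (a ℕ.* b) ≈ ι a * ι b
  ι-homo-* = ×1-homo-*

  ι-suc : ∀ n → ι (suc n) ≈ 1# + ι n
  ι-suc n = 1+× n 1#

  private
    Diff : Set
    Diff = ℕ × ℕ

    δ : Diff → Carrier
    δ (a , b) = ι a - ι b

    normalise : Diff → Diff
    normalise (a , b) = a ∸ b , b ∸ a

    coefficients : RawRing _ _
    coefficients = record
      { Carrier = Diff
      ; _≈_     = _≡_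
      ; _+_     = λ { (a , b) (a′ , b′) → normalise (a ℕ.+ a′ , b ℕ.+ b′) }
      ; _*_     = λ { (a , b) (a′ , b′) → normalise (a ℕ.* a′ ℕ.+ b ℕ.* b′ , a ℕ.* b′ ℕ.+ b ℕ.* a′) }
      ; -_      = λ { (a , b) → b , a }
      ; 0#      = 0 , 0
      ; 1#      = 1 , 0
      }

    ⟦_⟧ : Diff → Carrier
    ⟦ a , zero ⟧  = ι a
    ⟦ a , suc b ⟧ = δ (a , suc b)

    ⟦⟧≈δ : ∀ p → ⟦ p ⟧ ≈ δ p
    ⟦⟧≈δ (a , zero)  = sym (trans (+-congˡ -0#≈0#) (+-identityʳ _))
    ⟦⟧≈δ (a , suc b) = refl

    +-cancel-diff : ∀ x y z → (x + z) - (y + z) ≈ x - y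
    +-cancel-diff x y z = begin
      (x + z) - (y + z)     ≈⟨ +-congˡ (-‿+-comm y z) ⟨
      (x + z) + (- y - z)   ≈⟨ interchange x z (- y) (- z) ⟩
      (x - y) + (z - z)     ≈⟨ +-congˡ (-‿inverseʳ z) ⟩
      (x - y) + 0#          ≈⟨ +-identityʳ _ ⟩
      x - y                 ∎

    δ-cong : ∀ {a b a′ b′} → a ℕ.+ b′ ≡ a′ ℕ.+ b → δ (a , b) ≈ δ (a′ , b′)
    δ-cong {a} {b} {a′} {b′} eq = begin
      ι a - ι b                     ≈⟨ +-cancel-diff (ι a) (ι b) (ι b′) ⟨
      (ι a + ι b′) - (ι b + ι b′)   ≈⟨ +-cong ι-eq (-‿cong (+-comm (ι b) (ι b′))) ⟩
      (ι a′ + ι b) - (ι b′ + ι b)   ≈⟨ +-cancel-diff (ι a′) (ι b′) (ι b) ⟩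
      ι a′ - ι b′                   ∎
      where
      ι-eq : ι a + ι b′ ≈ ι a′ + ι b
      ι-eq = trans (sym (ι-homo-+ a b′)) (trans (reflexive (≡.cong ι eq)) (ι-homo-+ a′ b))

    ∸-+-swap : ∀ a b → (a ∸ b) ℕ.+ b ≡ a ℕ.+ (b ∸ a)
    ∸-+-swap zero    zero    = ≡.refl
    ∸-+-swap zero    (suc b) = ≡.refl
    ∸-+-swap (suc a) zero    = ≡.refl
    ∸-+-swap (suc a) (suc b) = ≡.trans (ℕ.+-suc (a ∸ b) b) (≡.cong suc (∸-+-swap a b))

    ⟦normalise⟧ : ∀ a b → ⟦ normalise (a , b) ⟧ ≈ δ (a , b)
    ⟦normalise⟧ a b = trans (⟦⟧≈δ (normalise (a , b))) (δ-cong {a ∸ b} {b ∸ a} {a} {b} (∸-+-swap a b))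

    δ-homo-+ : ∀ a b a′ b′ → δ (a ℕ.+ a′ , b ℕ.+ b′) ≈ δ (a , b) + δ (a′ , b′)
    δ-homo-+ a b a′ b′ = begin
      ι (a ℕ.+ a′) - ι (b ℕ.+ b′)        ≈⟨ +-cong (ι-homo-+ a a′) (-‿cong (ι-homo-+ b b′)) ⟩
      (ι a + ι a′) - (ι b + ι b′)        ≈⟨ +-congˡ (-‿+-comm (ι b) (ι b′)) ⟨
      (ι a + ι a′) + (- ι b - ι b′)      ≈⟨ interchange _ _ _ _ ⟩
      (ι a - ι b) + (ι a′ - ι b′)        ∎

    δ-homo-* : ∀ a b a′ b′ → δ (a ℕ.* a′ ℕ.+ b ℕ.* b′ , a ℕ.* b′ ℕ.+ b ℕ.* a′) ≈ δ (a , b) * δ (a′ , b′)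
    δ-homo-* a b a′ b′ = begin
      δ (a ℕ.* a′ ℕ.+ b ℕ.* b′ , a ℕ.* b′ ℕ.+ b ℕ.* a′)
        ≈⟨ δ-homo-+ (a ℕ.* a′) (a ℕ.* b′) (b ℕ.* b′) (b ℕ.* a′) ⟩
      δ (a ℕ.* a′ , a ℕ.* b′) + δ (b ℕ.* b′ , b ℕ.* a′)
        ≈⟨ +-cong (+-cong (ι-homo-* a a′) (-‿cong (ι-homo-* a b′)))
                  (+-cong (ι-homo-* b b′) (-‿cong (ι-homo-* b a′))) ⟩
      (ι a * ι a′ - ι a * ι b′) + (ι b * ι b′ - ι b * ι a′)
        ≈⟨ +-cong (+-congˡ (-‿distribʳ-* (ι a) (ι b′)))
                  (+-cong (sym (neg-*-neg (ι b) (ι b′))) (-‿distribˡ-* (ι b) (ι a′))) ⟩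
      (ι a * ι a′ + ι a * - ι b′) + (- ι b * - ι b′ + - ι b * ι a′)
        ≈⟨ +-cong (sym (distribˡ (ι a) (ι a′) (- ι b′)))
                  (trans (+-comm _ _) (sym (distribˡ (- ι b) (ι a′) (- ι b′)))) ⟩
      ι a * δ (a′ , b′) + - ι b * δ (a′ , b′)
        ≈⟨ distribʳ (δ (a′ , b′)) (ι a) (- ι b) ⟨
      δ (a , b) * δ (a′ , b′) ∎
      where
      neg-*-neg : ∀ x y → - x * - y ≈ x * y
      neg-*-neg x y = trans (sym (-‿distribˡ-* x (- y))) (trans (-‿cong (sym (-‿distribʳ-* x y))) (-‿involutive _))

    δ-swap : ∀ a b → δ (b , a) ≈ - δ (a , b)
    δ-swap a b = begin
      ι b - ι a       ≈⟨ +-comm _ _ ⟩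
      - ι a + ι b     ≈⟨ +-congˡ (-‿involutive _) ⟨
      - ι a - - ι b   ≈⟨ -‿+-comm (ι a) (- ι b) ⟩
      - (ι a - ι b)   ∎

    morphism : coefficients ACR.-Raw-AlmostCommutative⟶ ACR.fromCommutativeRing R
    morphism = record
      { ⟦_⟧    = ⟦_⟧
      ; +-homo = λ { (a , b) (a′ , b′) → trans (⟦normalise⟧ (a ℕ.+ a′) (b ℕ.+ b′))
                     (trans (δ-homo-+ a b a′ b′) (sym (+-cong (⟦⟧≈δ (a , b)) (⟦⟧≈δ (a′ , b′))))) }
      ; *-homo = λ { (a , b) (a′ , b′) → trans (⟦normalise⟧ (a ℕ.* a′ ℕ.+ b ℕ.* b′) (a ℕ.* b′ ℕ.+ b ℕ.* a′))
                     (trans (δ-homo-* a b a′ b′) (sym (*-cong (⟦⟧≈δ (a , b)) (⟦⟧≈δ (a′ , b′))))) }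
      ; -‿homo = λ { (a , b) → trans (⟦⟧≈δ (b , a)) (trans (δ-swap a b) (sym (-‿cong (⟦⟧≈δ (a , b))))) }
      ; 0-homo = refl
      ; 1-homo = refl
      }

    _≟⟦⟧_ : ∀ p p′ → Maybe (⟦ p ⟧ ≈ ⟦ p′ ⟧)
    (a , b) ≟⟦⟧ (a′ , b′) with a ℕ.+ b′ ℕ.≟ a′ ℕ.+ b
    ... | yes eq = just (trans (⟦⟧≈δ (a , b)) (trans (δ-cong {a} {b} {a′} {b′} eq) (sym (⟦⟧≈δ (a′ , b′)))))
    ... | no _   = nothing

  open Algebra.Solver.Ring coefficients (ACR.fromCommutativeRing R) morphism _≟⟦⟧_ public
    using (Polynomial; solve; _:=_; _:+_; _:*_; _:-_; :-_; con)

  :1 : ∀ {n} → Polynomial n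
  :1 = con (1 , 0)

module FieldProperties {c ℓ} (F : Field c ℓ) where

  open Field F
  open DifferenceSolver commutativeRing using (solve; _:=_; _:+_; _:*_; _:-_; :1)
  open import Relation.Binary.Reasoning.Setoid setoid
  open import Data.Nat using (zero; suc)

  x≉y⇒x-y≉0 : ∀ {x y} → ¬ x ≈ y → ¬ x - y ≈ 0#
  x≉y⇒x-y≉0 {x} {y} x≉y x-y≈0 = x≉y (begin
    x             ≈⟨ solve 2 (λ x y → x := (x :- y) :+ y) refl x y ⟩
    (x - y) + y   ≈⟨ +-congʳ x-y≈0 ⟩
    0# + y        ≈⟨ +-identityˡ y ⟩
    y             ∎)

  ⁻¹-cancelˡ : ∀ {x} y → ¬ x ≈ 0# → x ⁻¹ * (x * y) ≈ y
  ⁻¹-cancelˡ {x} y x≉0 = begin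
    x ⁻¹ * (x * y)   ≈⟨ *-assoc _ _ _ ⟨
    (x ⁻¹ * x) * y   ≈⟨ *-congʳ (trans (*-comm _ _) (⁻¹-inverse x x≉0)) ⟩
    1# * y           ≈⟨ *-identityˡ y ⟩
    y                ∎

  *-nonzero : ∀ {x y} → ¬ x ≈ 0# → ¬ y ≈ 0# → ¬ x * y ≈ 0#
  *-nonzero {x} {y} x≉0 y≉0 xy≈0 = y≉0 (trans (sym (⁻¹-cancelˡ y x≉0)) (trans (*-congˡ xy≈0) (zeroʳ _)))

  pow-nonzero : ∀ {x} → ¬ x ≈ 0# → ∀ j → ¬ pow F x j ≈ 0#
  pow-nonzero x≉0 zero    1≈0 = 0≉1 (sym 1≈0)
  pow-nonzero x≉0 (suc j) = *-nonzero x≉0 (pow-nonzero x≉0 j)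

  ⁻¹-unique : ∀ {x y} → ¬ x ≈ 0# → x * y ≈ 1# → y ≈ x ⁻¹
  ⁻¹-unique {x} {y} x≉0 xy≈1 = trans (sym (⁻¹-cancelˡ y x≉0)) (trans (*-congˡ xy≈1) (*-identityʳ _))

  ratio-shift : ∀ {q A C D C′ D′} → ¬ q ≈ 0# → ¬ A ≈ 0# → ¬ D ≈ 0# →
    D′ ≈ A * D → q * C′ - D′ ≈ q * C - D → C′ * D′ ⁻¹ ≈ q ⁻¹ + (C * D ⁻¹ - q ⁻¹) * A ⁻¹
  ratio-shift {q} {A} {C} {D} {C′} {D′} q≉0 A≉0 D≉0 D′≈AD qC′-D′≈qC-D = begin
    C′ * D′ ⁻¹
      ≈⟨ *-cong C′≈ D′⁻¹≈ ⟩
    q ⁻¹ * ((q * C - D) + A * D) * (A ⁻¹ * D ⁻¹)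
      ≈⟨ certificate q (q ⁻¹) A (A ⁻¹) C D (D ⁻¹) ⟩
    ((q ⁻¹ + (C * D ⁻¹ - q ⁻¹) * A ⁻¹) + (q * q ⁻¹ - 1#) * (C * A ⁻¹ * D ⁻¹))
      + ((A * A ⁻¹ - 1#) * (q ⁻¹ * D * D ⁻¹) + (D * D ⁻¹ - 1#) * (q ⁻¹ - q ⁻¹ * A ⁻¹))
      ≈⟨ +-cong (+-congˡ (vanishes q≉0 _)) (+-cong (vanishes A≉0 _) (vanishes D≉0 _)) ⟩
    ((q ⁻¹ + (C * D ⁻¹ - q ⁻¹) * A ⁻¹) + 0#) + (0# + 0#)
      ≈⟨ trans (+-cong (+-identityʳ _) (+-identityʳ 0#)) (+-identityʳ _) ⟩
    q ⁻¹ + (C * D ⁻¹ - q ⁻¹) * A ⁻¹ ∎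
    where
    vanishes : ∀ {x} → ¬ x ≈ 0# → ∀ t → (x * x ⁻¹ - 1#) * t ≈ 0#
    vanishes {x} x≉0 t = trans (*-congʳ (trans (+-congʳ (⁻¹-inverse x x≉0)) (-‿inverseʳ 1#))) (zeroˡ t)
    -- The two sides differ by multiples of q q⁻¹ − 1, A A⁻¹ − 1 and D D⁻¹ − 1.
    certificate : ∀ q q′ A A′ C D D′ → q′ * ((q * C - D) + A * D) * (A′ * D′)
      ≈ ((q′ + (C * D′ - q′) * A′) + (q * q′ - 1#) * (C * A′ * D′))
        + ((A * A′ - 1#) * (q′ * D * D′) + (D * D′ - 1#) * (q′ - q′ * A′))
    certificate = solve 7 (λ q q′ A A′ C D D′ → q′ :* ((q :* C :- D) :+ A :* D) :* (A′ :* D′)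
      := ((q′ :+ (C :* D′ :- q′) :* A′) :+ (q :* q′ :- :1) :* (C :* A′ :* D′))
         :+ ((A :* A′ :- :1) :* (q′ :* D :* D′) :+ (D :* D′ :- :1) :* (q′ :- q′ :* A′))) refl
    C′≈ : C′ ≈ q ⁻¹ * ((q * C - D) + A * D)
    C′≈ = begin
      C′                          ≈⟨ ⁻¹-cancelˡ C′ q≉0 ⟨
      q ⁻¹ * (q * C′)             ≈⟨ *-congˡ (solve 2 (λ x d → x := (x :- d) :+ d) refl (q * C′) D′) ⟩
      q ⁻¹ * ((q * C′ - D′) + D′) ≈⟨ *-congˡ (+-cong qC′-D′≈qC-D D′≈AD) ⟩
      q ⁻¹ * ((q * C - D) + A * D) ∎
    D′⁻¹≈ : D′ ⁻¹ ≈ A ⁻¹ * D ⁻¹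
    D′⁻¹≈ = sym (⁻¹-unique (λ D′≈0 → *-nonzero A≉0 D≉0 (trans (sym D′≈AD) D′≈0)) (begin
      D′ * (A ⁻¹ * D ⁻¹)           ≈⟨ *-congʳ D′≈AD ⟩
      (A * D) * (A ⁻¹ * D ⁻¹)
        ≈⟨ solve 4 (λ A D A′ D′ → (A :* D) :* (A′ :* D′) := (A :* A′) :* (D :* D′)) refl A D (A ⁻¹) (D ⁻¹) ⟩
      (A * A ⁻¹) * (D * D ⁻¹)      ≈⟨ *-cong (⁻¹-inverse A A≉0) (⁻¹-inverse D D≉0) ⟩
      1# * 1#                      ≈⟨ *-identityˡ 1# ⟩
      1#                           ∎))

module SurjectiveColourings where

  open import Data.Bool using (Bool; T; true; false; not; _∧_; if_then_else_)
  open import Data.Bool.Properties using (∧-zeroʳ; ∧-identityʳ; ∧-conicalˡ; ∧-conicalʳ; ⇔→≡; T-≡)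
  open import Data.Bool.ListAction using (all; any)
  open import Data.Empty using (⊥-elim)
  open import Data.Fin using (Fin; zero; suc; punchIn; punchOut; inject₁; fromℕ)
  import Data.Fin.Properties as Fin
  open import Data.List using (List; []; _∷_; map; concatMap; _++_; length; allFin; tabulate)
  import Data.List.Properties as List
  import Data.List.Relation.Unary.All as All
  open import Data.List.Relation.Unary.All.Properties using (all⁺; all⁻)
  open import Data.List.Relation.Unary.Any using (satisfied)
  open import Data.List.Relation.Unary.Any.Properties using (any⁺; any⁻)
  open import Data.List.Membership.Propositional using (lose)
  open import Data.List.Membership.Propositional.Properties using (∈-allFin)
  open import Data.Nat using (ℕ; zero; suc; _+_; _*_; _<_; _!; s≤s; z≤n)
  open import Data.Nat.Divisibility using (_∣_; _∣0; 1∣_; ∣-trans; n∣m*n; *-monoʳ-∣; ∣m∣n⇒∣m+n; ∣m+n∣m⇒∣n)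
  open import Data.Nat.DivMod using (m/n*n≡m)
  open import Data.Nat.Tactic.RingSolver using (solve-∀)
  open import Data.Nat.Properties
  open import Algebra.Properties.CommutativeSemigroup +-commutativeSemigroup using () renaming (interchange to +-interchange)
  open import Data.Product using (∃; _,_; proj₁; proj₂)
  open import Data.Vec.Functional using () renaming (_∷_ to _◃_)
  open import Function using (_∘_; id; Equivalence; mk⇔)
  open import Relation.Binary.PropositionalEquality
  open import Relation.Nullary using (yes; no)
  open import Relation.Nullary.Decidable using (dec-true)

  ==⇒≡ : ∀ {n} {i j : Fin n} → i == j ≡ true → i ≡ j
  ==⇒≡ {i = i} {j} h with i Fin.≟ j
  ... | yes i≡j = i≡j

  ≡⇒== : ∀ {n} {i j : Fin n} → i ≡ j → i == j ≡ true
  ≡⇒== {i = i} {j} = dec-true (i Fin.≟ j)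

  iverson : Bool → ℕ
  iverson b = if b then 1 else 0

  iverson-∧ : ∀ a b → iverson (a ∧ b) ≡ iverson a * iverson b
  iverson-∧ true  b = sym (+-identityʳ _)
  iverson-∧ false b = refl

  sumBy : ∀ {A : Set} → (A → ℕ) → List A → ℕ
  sumBy f []       = 0
  sumBy f (x ∷ xs) = f x + sumBy f xs

  module _ {A : Set} where

    countTrue≡sumBy : ∀ (p : A → Bool) xs → countTrue p xs ≡ sumBy (iverson ∘ p) xs
    countTrue≡sumBy p []       = refl
    countTrue≡sumBy p (x ∷ xs) = cong (iverson (p x) +_) (countTrue≡sumBy p xs)

    countTrue-cong : ∀ {p q : A → Bool} xs → (∀ x → p x ≡ q x) → countTrue p xs ≡ countTrue q xs
    countTrue-cong []       p≡q = refl
    countTrue-cong (x ∷ xs) p≡q = cong₂ _+_ (cong iverson (p≡q x)) (countTrue-cong xs p≡q)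

    countTrue-none : ∀ {p : A → Bool} xs → (∀ x → p x ≡ false) → countTrue p xs ≡ 0
    countTrue-none []       p≡false = refl
    countTrue-none (x ∷ xs) p≡false = cong₂ _+_ (cong iverson (p≡false x)) (countTrue-none xs p≡false)

    countTrue-split : ∀ (p t : A → Bool) xs →
      countTrue p xs ≡ countTrue (λ x → p x ∧ not (t x)) xs + countTrue (λ x → p x ∧ t x) xs
    countTrue-split p t []       = refl
    countTrue-split p t (x ∷ xs) = trans (cong₂ _+_ (split (p x) (t x)) (countTrue-split p t xs))
      (+-interchange (iverson (p x ∧ not (t x))) (iverson (p x ∧ t x)) _ _)
      where
      split : ∀ a b → iverson a ≡ iverson (a ∧ not b) + iverson (a ∧ b)
      split true  true  = refl
      split true  false = refl
      split false b     = refl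

    sumBy-cong : ∀ {f g : A → ℕ} xs → (∀ x → f x ≡ g x) → sumBy f xs ≡ sumBy g xs
    sumBy-cong []       f≡g = refl
    sumBy-cong (x ∷ xs) f≡g = cong₂ _+_ (f≡g x) (sumBy-cong xs f≡g)

    sumBy-zero : ∀ {f : A → ℕ} xs → (∀ x → f x ≡ 0) → sumBy f xs ≡ 0
    sumBy-zero []       f≡0 = refl
    sumBy-zero (x ∷ xs) f≡0 = cong₂ _+_ (f≡0 x) (sumBy-zero xs f≡0)

    sumBy-const : ∀ c xs → sumBy {A} (λ _ → c) xs ≡ length xs * c
    sumBy-const c []       = refl
    sumBy-const c (x ∷ xs) = cong (c +_) (sumBy-const c xs)

    sumBy-+ : ∀ (f g : A → ℕ) xs → sumBy (λ x → f x + g x) xs ≡ sumBy f xs + sumBy g xs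
    sumBy-+ f g []       = refl
    sumBy-+ f g (x ∷ xs) = trans (cong (f x + g x +_) (sumBy-+ f g xs)) (+-interchange (f x) (g x) _ _)

    sumBy-*ˡ : ∀ k (f : A → ℕ) xs → sumBy (λ x → k * f x) xs ≡ k * sumBy f xs
    sumBy-*ˡ k f []       = sym (*-zeroʳ k)
    sumBy-*ˡ k f (x ∷ xs) = trans (cong (k * f x +_) (sumBy-*ˡ k f xs)) (sym (*-distribˡ-+ k (f x) _))

    sumBy-++ : ∀ (f : A → ℕ) xs ys → sumBy f (xs ++ ys) ≡ sumBy f xs + sumBy f ys
    sumBy-++ f []       ys = refl
    sumBy-++ f (x ∷ xs) ys = trans (cong (f x +_) (sumBy-++ f xs ys)) (sym (+-assoc (f x) _ _))

  module _ {A B : Set} where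

    sumBy-map : ∀ (f : B → ℕ) (g : A → B) xs → sumBy f (map g xs) ≡ sumBy (f ∘ g) xs
    sumBy-map f g []       = refl
    sumBy-map f g (x ∷ xs) = cong (f (g x) +_) (sumBy-map f g xs)

    sumBy-concatMap : ∀ (f : B → ℕ) (g : A → List B) xs →
      sumBy f (concatMap g xs) ≡ sumBy (λ x → sumBy f (g x)) xs
    sumBy-concatMap f g []       = refl
    sumBy-concatMap f g (x ∷ xs) =
      trans (sumBy-++ f (g x) (concatMap g xs)) (cong (sumBy f (g x) +_) (sumBy-concatMap f g xs))

    sumBy-swap : ∀ (f : A → B → ℕ) xs ys →
      sumBy (λ x → sumBy (f x) ys) xs ≡ sumBy (λ y → sumBy (λ x → f x y) xs) ys
    sumBy-swap f []       ys = sym (sumBy-zero ys (λ _ → refl))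
    sumBy-swap f (x ∷ xs) ys =
      trans (cong (sumBy (f x) ys +_) (sumBy-swap f xs ys)) (sym (sumBy-+ (f x) (λ y → sumBy (λ x′ → f x′ y) xs) ys))

  sumBy-allFin-suc : ∀ n (h : Fin (suc n) → ℕ) → sumBy h (allFin (suc n)) ≡ h zero + sumBy (h ∘ suc) (allFin n)
  sumBy-allFin-suc n h =
    cong (h zero +_) (trans (cong (sumBy h) (sym (List.map-tabulate id suc))) (sumBy-map h suc (allFin n)))

  sumBy-allFin-const : ∀ n c → sumBy (λ _ → c) (allFin n) ≡ n * c
  sumBy-allFin-const n c = trans (sumBy-const c (allFin n)) (cong (_* c) (List.length-tabulate {n = n} id))

  count-allFin-≡ : ∀ {n} (x : Fin n) → sumBy (λ j → iverson (j == x)) (allFin n) ≡ 1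
  count-allFin-≡ {suc n} zero    =
    trans (sumBy-allFin-suc n (λ j → iverson (j == zero))) (cong suc (sumBy-zero (allFin n) (λ _ → refl)))
  count-allFin-≡ {suc n} (suc x) = trans (sumBy-allFin-suc n (λ j → iverson (j == suc x))) (count-allFin-≡ x)

  count-allFin-≢ : ∀ {n} (x : Fin (suc n)) → sumBy (λ j → iverson (not (j == x))) (allFin (suc n)) ≡ n
  count-allFin-≢ {n}     zero    =
    trans (sumBy-allFin-suc n (λ j → iverson (not (j == zero)))) (trans (sumBy-allFin-const n 1) (*-identityʳ n))
  count-allFin-≢ {suc n} (suc x) =
    trans (sumBy-allFin-suc (suc n) (λ j → iverson (not (j == suc x)))) (cong suc (count-allFin-≢ x))

  Colouring : ℕ → ℕ → Set
  Colouring n k = Fin n → Fin k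

  Surjective : ∀ {n k} → Colouring n k → Set
  Surjective {n} {k} c = ∀ j → ∃ λ (i : Fin n) → c i ≡ j

  isOnto⇒surjective : ∀ {n k} (c : Colouring n k) → isOnto c ≡ true → Surjective c
  isOnto⇒surjective {n} {k} c onto j =
    let i , ci==j = satisfied (any⁻ _ (allFin n) hit) in i , ==⇒≡ (Equivalence.to T-≡ ci==j)
    where
    hit : T (any (λ i → c i == j) (allFin n))
    hit = All.lookup (all⁺ _ (allFin k) (Equivalence.from T-≡ onto)) (∈-allFin j)

  surjective⇒isOnto : ∀ {n k} (c : Colouring n k) → Surjective c → isOnto c ≡ true
  surjective⇒isOnto {n} {k} c surj = Equivalence.to T-≡ (all⁻ _ {allFin k} (All.tabulate λ {j} _ → hit j))
    where
    hit : ∀ j → T (any (λ i → c i == j) (allFin n))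
    hit j = any⁺ (λ i → c i == j) (lose (∈-allFin (proj₁ (surj j))) (Equivalence.from T-≡ (≡⇒== (proj₂ (surj j)))))

  isOnto-cong : ∀ {n k} {c c′ : Colouring n k} → c ≗ c′ → isOnto c ≡ isOnto c′
  isOnto-cong {c = c} {c′} c≗c′ = ⇔→≡ (mk⇔
    (λ h → surjective⇒isOnto c′ λ j → let i , ci≡j = isOnto⇒surjective c h j in i , trans (sym (c≗c′ i)) ci≡j)
    (λ h → surjective⇒isOnto c  λ j → let i , ci≡j = isOnto⇒surjective c′ h j in i , trans (c≗c′ i) ci≡j))

  all-cong : ∀ {A : Set} {p q : A → Bool} xs → (∀ x → p x ≡ q x) → all p xs ≡ all q xs
  all-cong []       p≡q = refl
  all-cong (x ∷ xs) p≡q = cong₂ _∧_ (p≡q x) (all-cong xs p≡q)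

  all-map : ∀ {A B : Set} (p : B → Bool) (g : A → B) xs → all p (map g xs) ≡ all (p ∘ g) xs
  all-map p g []       = refl
  all-map p g (x ∷ xs) = cong (p (g x) ∧_) (all-map p g xs)

  isProper-cong : ∀ G {k} {c c′ : Colouring (nV G) k} → c ≗ c′ → isProper G c ≡ isProper G c′
  isProper-cong G c≗c′ = all-cong (edges G) (λ (u , v) → cong not (cong₂ _==_ (c≗c′ u) (c≗c′ v)))

  _≗ᵇ_ : ∀ {n k} → Colouring n k → Colouring n k → Bool
  _≗ᵇ_ {zero}  f g = true
  _≗ᵇ_ {suc n} f g = (f zero == g zero) ∧ ((f ∘ suc) ≗ᵇ (g ∘ suc))

  ≗ᵇ⇒≗ : ∀ {n k} (f g : Colouring n k) → f ≗ᵇ g ≡ true → f ≗ g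
  ≗ᵇ⇒≗ {suc n} f g h zero    = ==⇒≡ (∧-conicalˡ _ _ h)
  ≗ᵇ⇒≗ {suc n} f g h (suc i) = ≗ᵇ⇒≗ (f ∘ suc) (g ∘ suc) (∧-conicalʳ (f zero == g zero) _ h) i

  ≗⇒≗ᵇ : ∀ {n k} (f g : Colouring n k) → f ≗ g → f ≗ᵇ g ≡ true
  ≗⇒≗ᵇ {zero}  f g f≗g = refl
  ≗⇒≗ᵇ {suc n} f g f≗g = cong₂ _∧_ (≡⇒== (f≗g zero)) (≗⇒≗ᵇ (f ∘ suc) (g ∘ suc) (f≗g ∘ suc))

  ≗ᵇ-resp : ∀ {n k} {f f′ g g′ : Colouring n k} → f ≗ f′ → g ≗ g′ → f ≗ᵇ g ≡ f′ ≗ᵇ g′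
  ≗ᵇ-resp {f = f} {f′} {g} {g′} f≗f′ g≗g′ = ⇔→≡ (mk⇔
    (λ h → ≗⇒≗ᵇ f′ g′ λ i → trans (sym (f≗f′ i)) (trans (≗ᵇ⇒≗ f g h i) (g≗g′ i)))
    (λ h → ≗⇒≗ᵇ f g λ i → trans (f≗f′ i) (trans (≗ᵇ⇒≗ f′ g′ h i) (sym (g≗g′ i)))))

  ≗ᵇ-sym : ∀ {n k} (f g : Colouring n k) → f ≗ᵇ g ≡ g ≗ᵇ f
  ≗ᵇ-sym f g = ⇔→≡ (mk⇔ (λ h → ≗⇒≗ᵇ g f (sym ∘ ≗ᵇ⇒≗ f g h))
                       (λ h → ≗⇒≗ᵇ f g (sym ∘ ≗ᵇ⇒≗ g f h)))

  Respects≗ : ∀ {n k} → (Colouring n k → ℕ) → Set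
  Respects≗ F = ∀ {f g} → f ≗ g → F f ≡ F g

  sumBy-allMaps-suc : ∀ {n k} (F : Colouring (suc n) k → ℕ) → Respects≗ F →
    sumBy F (allMaps (suc n) k) ≡ sumBy (λ j → sumBy (λ f → F (j ◃ f)) (allMaps n k)) (allFin k)
  sumBy-allMaps-suc {n} {k} F F-resp = trans (sumBy-concatMap F _ (allFin k))
    (sumBy-cong (allFin k) λ j → trans (sumBy-map F _ (allMaps n k))
      (sumBy-cong (allMaps n k) λ f → F-resp λ { zero → refl ; (suc i) → refl }))

  -- allMaps n k lists each colouring once, but its entries are pattern lambdas that are only
  -- pointwise equal to any given colouring, hence the Boolean test ≗ᵇ.
  allMaps-once : ∀ n {k} (g : Colouring n k) → sumBy (λ f → iverson (f ≗ᵇ g)) (allMaps n k) ≡ 1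
  allMaps-once zero    g = refl
  allMaps-once (suc n) {k} g = begin
    sumBy (λ f → iverson (f ≗ᵇ g)) (allMaps (suc n) k)
      ≡⟨ sumBy-allMaps-suc (λ f → iverson (f ≗ᵇ g)) (λ f≗f′ → cong iverson (≗ᵇ-resp {g = g} f≗f′ λ _ → refl)) ⟩
    sumBy (λ j → sumBy (λ f → iverson ((j == g zero) ∧ (f ≗ᵇ (g ∘ suc)))) (allMaps n k)) (allFin k)
      ≡⟨ sumBy-cong (allFin k) first-colour ⟩
    sumBy (λ j → iverson (j == g zero)) (allFin k)
      ≡⟨ count-allFin-≡ (g zero) ⟩
    1 ∎
    where
    open ≡-Reasoning
    first-colour : ∀ j → sumBy (λ f → iverson ((j == g zero) ∧ (f ≗ᵇ (g ∘ suc)))) (allMaps n k) ≡ iverson (j == g zero)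
    first-colour j = begin
      sumBy (λ f → iverson ((j == g zero) ∧ (f ≗ᵇ (g ∘ suc)))) (allMaps n k)
        ≡⟨ sumBy-cong (allMaps n k) (λ f → iverson-∧ (j == g zero) (f ≗ᵇ (g ∘ suc))) ⟩
      sumBy (λ f → iverson (j == g zero) * iverson (f ≗ᵇ (g ∘ suc))) (allMaps n k)
        ≡⟨ sumBy-*ˡ (iverson (j == g zero)) _ (allMaps n k) ⟩
      iverson (j == g zero) * sumBy (λ f → iverson (f ≗ᵇ (g ∘ suc))) (allMaps n k)
        ≡⟨ cong (iverson (j == g zero) *_) (allMaps-once n (g ∘ suc)) ⟩
      iverson (j == g zero) * 1
        ≡⟨ *-identityʳ _ ⟩
      iverson (j == g zero) ∎

  record Correspondence {m n k k′} (p : Colouring m k → Bool) (q : Colouring n k′ → Bool) : Set where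
    field
      ψ           : Colouring n k′ → Colouring m k
      p-cong      : ∀ {c c′} → c ≗ c′ → p c ≡ p c′
      ψ-cong      : ∀ {d d′} → d ≗ d′ → ψ d ≗ ψ d′
      ψ-injective : ∀ {d d′} → ψ d ≗ ψ d′ → d ≗ d′
      p∘ψ≡q       : ∀ d → p (ψ d) ≡ q d
      ψ-onto      : ∀ c → p c ≡ true → ∃ λ d → ψ d ≗ c

  -- Both sides count the pairs (c , d) with p c and c ≗ ψ d.
  countTrue-correspondence : ∀ {m n k k′} {p : Colouring m k → Bool} {q : Colouring n k′ → Bool} →
    Correspondence p q → countTrue p (allMaps m k) ≡ countTrue q (allMaps n k′)
  countTrue-correspondence {m} {n} {k} {k′} {p} {q} corr = begin
    countTrue p cs                                            ≡⟨ countTrue≡sumBy p cs ⟩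
    sumBy (iverson ∘ p) cs                                    ≡⟨ sumBy-cong cs fibre-over-c ⟩
    sumBy (λ c → sumBy (λ d → iverson (pair c d)) ds) cs      ≡⟨ sumBy-swap (λ c d → iverson (pair c d)) cs ds ⟩
    sumBy (λ d → sumBy (λ c → iverson (pair c d)) cs) ds      ≡⟨ sumBy-cong ds fibre-over-d ⟩
    sumBy (iverson ∘ q) ds                                    ≡⟨ countTrue≡sumBy q ds ⟨
    countTrue q ds                                            ∎
    where
    open ≡-Reasoning
    open Correspondence corr
    cs = allMaps m k
    ds = allMaps n k′
    pair : Colouring m k → Colouring n k′ → Bool
    pair c d = p c ∧ (ψ d ≗ᵇ c)

    fibre-over-c : ∀ c → iverson (p c) ≡ sumBy (λ d → iverson (pair c d)) ds
    fibre-over-c c with p c in pc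
    ... | false = sym (sumBy-zero ds λ _ → refl)
    ... | true with ψ-onto c pc
    ...   | d₀ , ψd₀≗c = sym (trans (sumBy-cong ds λ d → cong iverson (ψd≗c⇔d≗d₀ d)) (allMaps-once n d₀))
      where
      ψd≗c⇔d≗d₀ : ∀ d → ψ d ≗ᵇ c ≡ d ≗ᵇ d₀
      ψd≗c⇔d≗d₀ d = ⇔→≡ (mk⇔
        (λ h → ≗⇒≗ᵇ d d₀ (ψ-injective λ x → trans (≗ᵇ⇒≗ (ψ d) c h x) (sym (ψd₀≗c x))))
        (λ h → ≗⇒≗ᵇ (ψ d) c λ x → trans (ψ-cong (≗ᵇ⇒≗ d d₀ h) x) (ψd₀≗c x)))

    pair≡ : ∀ c d → pair c d ≡ q d ∧ (c ≗ᵇ ψ d)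
    pair≡ c d with ψ d ≗ᵇ c in h
    ... | true  = cong₂ _∧_ (trans (p-cong (sym ∘ ≗ᵇ⇒≗ (ψ d) c h)) (p∘ψ≡q d)) (sym (trans (≗ᵇ-sym c (ψ d)) h))
    ... | false = trans (∧-zeroʳ (p c)) (sym (trans (cong (q d ∧_) (trans (≗ᵇ-sym c (ψ d)) h)) (∧-zeroʳ (q d))))

    fibre-over-d : ∀ d → sumBy (λ c → iverson (pair c d)) cs ≡ iverson (q d)
    fibre-over-d d = trans (sumBy-cong cs λ c → cong iverson (pair≡ c d)) (by-q (q d))
      where
      by-q : ∀ b → sumBy (λ c → iverson (b ∧ (c ≗ᵇ ψ d))) cs ≡ iverson b
      by-q true  = allMaps-once m (ψ d)
      by-q false = sumBy-zero cs λ _ → refl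

  isOnto-∘ : ∀ {m n k} (σ : Fin m → Fin n) → Surjective σ → (d : Colouring n k) → isOnto (d ∘ σ) ≡ isOnto d
  isOnto-∘ σ σ-onto d = ⇔→≡ (mk⇔
    (λ h → surjective⇒isOnto d λ j → let v , dσv≡j = isOnto⇒surjective (d ∘ σ) h j in σ v , dσv≡j)
    (λ h → surjective⇒isOnto (d ∘ σ) λ j → lift (isOnto⇒surjective d h j)))
    where
    lift : ∀ {j} → ∃ (λ i → d i ≡ j) → ∃ λ v → d (σ v) ≡ j
    lift (i , di≡j) = let v , σv≡i = σ-onto i in v , trans (cong d σv≡i) di≡j

  module Identification {n} (a b : Fin (suc n)) (a≢b : a ≢ b) where

    μ : Fin (suc n) → Fin n
    μ = merge a b a≢b

    punchIn-merge : ∀ {v} → v ≢ b → punchIn b (μ v) ≡ v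
    punchIn-merge {v} v≢b with v Fin.≟ b
    ... | yes v≡b  = ⊥-elim (v≢b v≡b)
    ... | no  v≢b′ = Fin.punchIn-punchOut (v≢b′ ∘ sym)

    punchIn-merge-b : punchIn b (μ b) ≡ a
    punchIn-merge-b with b Fin.≟ b
    ... | yes _   = Fin.punchIn-punchOut (a≢b ∘ sym)
    ... | no b≢b  = ⊥-elim (b≢b refl)

    merge-punchIn : ∀ i → μ (punchIn b i) ≡ i
    merge-punchIn i = Fin.punchIn-injective b _ _ (punchIn-merge (Fin.punchInᵢ≢i b i))

    merge-a≡merge-b : μ a ≡ μ b
    merge-a≡merge-b = Fin.punchIn-injective b _ _ (trans (punchIn-merge a≢b) (sym punchIn-merge-b))

    -- Colourings giving a and b the same colour are exactly those factoring through μ.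
    identify : ∀ es k → let G = graph (suc n) es ; G/ab = graph n (map (λ (u , v) → μ u , μ v) es) in
      Correspondence {k = k} {k′ = k} (λ c → (isProper G c ∧ isOnto c) ∧ (c a == c b)) (λ d → isProper G/ab d ∧ isOnto d)
    identify es k = record
      { ψ           = _∘ μ
      ; p-cong      = λ c≗c′ → cong₂ _∧_ (cong₂ _∧_ (isProper-cong G c≗c′) (isOnto-cong c≗c′))
                                         (cong₂ _==_ (c≗c′ a) (c≗c′ b))
      ; ψ-cong      = λ d≗d′ → d≗d′ ∘ μ
      ; ψ-injective = λ {d} {d′} dμ≗d′μ i →
          trans (cong d (sym (merge-punchIn i))) (trans (dμ≗d′μ (punchIn b i)) (cong d′ (merge-punchIn i)))
      ; p∘ψ≡q       = λ d → trans
          (cong₂ _∧_ (cong₂ _∧_ (sym (all-map _ _ es)) (isOnto-∘ μ (λ i → punchIn b i , merge-punchIn i) d))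
                     (≡⇒== (cong d merge-a≡merge-b)))
          (∧-identityʳ _)
      ; ψ-onto      = λ c h → c ∘ punchIn b , factor c (==⇒≡ (∧-conicalʳ (isProper G c ∧ isOnto c) _ h))
      }
      where
      G = graph (suc n) es
      factor : ∀ c → c a ≡ c b → ∀ v → c (punchIn b (μ v)) ≡ c v
      factor c ca≡cb v with v Fin.≟ b
      ... | yes refl = trans (cong c punchIn-merge-b) ca≡cb
      ... | no  v≢b  = cong c (punchIn-merge v≢b)

  surjColourings-deletion-contraction : ∀ n (a b : Fin (suc n)) es k →
    surjColourings (graph (suc n) es) k
      ≡ surjColourings (graph (suc n) ((a , b) ∷ es)) k + surjColourings (contractAt (suc n) a b es) k
  surjColourings-deletion-contraction n a b es k with a Fin.≟ b
  -- A loop admits no proper colouring, and contracting it deletes it.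
  ... | yes refl = cong (_+ surjColourings (graph (suc n) es) k)
                     (sym (countTrue-none (allMaps (suc n) k) λ c → cong (λ x → (not x ∧ _) ∧ _) (≡⇒== {i = c a} refl)))
  ... | no a≢b   = trans (countTrue-split p (λ c → c a == c b) cs)
                     (cong₂ _+_ (countTrue-cong cs λ c → rearrange (isProper G c) (isOnto c) (c a == c b))
                                (countTrue-correspondence (identify es k)))
    where
    open Identification a b a≢b
    G  = graph (suc n) es
    cs = allMaps (suc n) k
    p : Colouring (suc n) k → Bool
    p c = isProper G c ∧ isOnto c
    rearrange : ∀ x y z → (x ∧ y) ∧ not z ≡ (not z ∧ x) ∧ y
    rearrange true  true  true  = refl
    rearrange true  true  false = refl
    rearrange true  false true  = refl
    rearrange true  false false = refl
    rearrange false y     true  = refl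
    rearrange false y     false = refl

  isOnto-◃ : ∀ {n k} (j : Fin k) (f : Colouring n k) → isOnto f ≡ true → isOnto (j ◃ f) ≡ true
  isOnto-◃ j f onto = surjective⇒isOnto (j ◃ f) λ i → let v , fv≡i = isOnto⇒surjective f onto i in suc v , fv≡i

  isOnto-◃⁻ : ∀ {n k} (j : Fin k) (f : Colouring n k) → isOnto (j ◃ f) ≡ true → (∃ λ v → f v ≡ j) → isOnto f ≡ true
  isOnto-◃⁻ j f onto (v , fv≡j) = surjective⇒isOnto f hit
    where
    hit : Surjective f
    hit i with isOnto⇒surjective (j ◃ f) onto i
    ... | zero  , j≡i  = v , trans fv≡j j≡i
    ... | suc w , fw≡i = w , fw≡i

  isProper-punchIn : ∀ G {k} (j : Fin (suc k)) (g : Colouring (nV G) k) → isProper G (punchIn j ∘ g) ≡ isProper G g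
  isProper-punchIn G j g = all-cong (edges G) λ (u , v) → cong not (⇔→≡ (mk⇔
    (λ h → ≡⇒== (Fin.punchIn-injective j _ _ (==⇒≡ h)))
    (λ h → ≡⇒== (cong (punchIn j) (==⇒≡ h)))))

  -- A colouring f whose extension j ◃ f is onto but which is not onto itself misses exactly
  -- the colour j, so it is punchIn j ∘ g for a unique onto g with one colour less.
  module MissingColour (G : Graph) {k′ : ℕ} (j : Fin (suc k′)) where

    missesOnly : Colouring (nV G) (suc k′) → Bool
    missesOnly f = (isProper G f ∧ not (isOnto f)) ∧ isOnto (j ◃ f)

    private
      punchIn-not-onto : ∀ (g : Colouring (nV G) k′) → isOnto (punchIn j ∘ g) ≡ false
      punchIn-not-onto g with isOnto (punchIn j ∘ g) in onto
      ... | false = refl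
      ... | true  = ⊥-elim (Fin.punchInᵢ≢i j _ (proj₂ (isOnto⇒surjective (punchIn j ∘ g) onto j)))

      isOnto-◃-punchIn : ∀ (g : Colouring (nV G) k′) → isOnto (j ◃ (punchIn j ∘ g)) ≡ isOnto g
      isOnto-◃-punchIn g = ⇔→≡ (mk⇔
        (λ h → surjective⇒isOnto g λ i → unpunch i (isOnto⇒surjective (j ◃ (punchIn j ∘ g)) h (punchIn j i)))
        (λ h → surjective⇒isOnto (j ◃ (punchIn j ∘ g)) (hit h)))
        where
        unpunch : ∀ i → ∃ (λ w → (j ◃ (punchIn j ∘ g)) w ≡ punchIn j i) → ∃ λ v → g v ≡ i
        unpunch i (zero  , j≡i)  = ⊥-elim (Fin.punchInᵢ≢i j i (sym j≡i))
        unpunch i (suc v , gv≡i) = v , Fin.punchIn-injective j _ _ gv≡i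
        hit : isOnto g ≡ true → Surjective (j ◃ (punchIn j ∘ g))
        hit onto i with j Fin.≟ i
        ... | yes j≡i = zero , j≡i
        ... | no  j≢i = let v , gv≡i = isOnto⇒surjective g onto (punchOut j≢i) in
                        suc v , trans (cong (punchIn j) gv≡i) (Fin.punchIn-punchOut j≢i)

    punchIn-correspondence : Correspondence missesOnly (λ g → isProper G g ∧ isOnto g)
    punchIn-correspondence = record
      { ψ           = punchIn j ∘_
      ; p-cong      = λ {c} {c′} c≗c′ → cong₂ _∧_ (cong₂ _∧_ (isProper-cong G c≗c′) (cong not (isOnto-cong c≗c′)))
                                                   (isOnto-cong {c = j ◃ c} {j ◃ c′} λ { zero → refl ; (suc i) → c≗c′ i })
      ; ψ-cong      = λ g≗g′ → cong (punchIn j) ∘ g≗g′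
      ; ψ-injective = λ jg≗jg′ v → Fin.punchIn-injective j _ _ (jg≗jg′ v)
      ; p∘ψ≡q       = λ g → begin
          (isProper G (punchIn j ∘ g) ∧ not (isOnto (punchIn j ∘ g))) ∧ isOnto (j ◃ (punchIn j ∘ g))
            ≡⟨ cong₂ (λ x y → (x ∧ not y) ∧ isOnto (j ◃ (punchIn j ∘ g))) (isProper-punchIn G j g) (punchIn-not-onto g) ⟩
          (isProper G g ∧ true) ∧ isOnto (j ◃ (punchIn j ∘ g))
            ≡⟨ cong₂ _∧_ (∧-identityʳ (isProper G g)) (isOnto-◃-punchIn g) ⟩
          isProper G g ∧ isOnto g ∎
      ; ψ-onto      = λ f h → (λ v → punchOut (avoids f h v ∘ sym)) , λ v → Fin.punchIn-punchOut _
      }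
      where
      open ≡-Reasoning
      avoids : ∀ f → missesOnly f ≡ true → ∀ v → f v ≢ j
      avoids f h v fv≡j with trans (sym not-onto) (cong not (isOnto-◃⁻ j f onto◃ (v , fv≡j)))
        where
        onto◃ : isOnto (j ◃ f) ≡ true
        onto◃ = ∧-conicalʳ (isProper G f ∧ not (isOnto f)) _ h
        not-onto : not (isOnto f) ≡ true
        not-onto = ∧-conicalʳ (isProper G f) _ (∧-conicalˡ _ _ h)
      ... | ()

    count-missesOnly : countTrue missesOnly (allMaps (nV G) (suc k′)) ≡ surjColourings G k′
    count-missesOnly = countTrue-correspondence punchIn-correspondence

  -- A new vertex 0 is coloured by a colour j that is allowed next to the colouring f of G.  If f is
  -- onto, each of the e allowed colours gives an onto colouring; otherwise j must be the single
  -- colour that f misses, which the hypothesis allowed-needed permits.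
  module NewVertex (G : Graph) {k′ : ℕ} (allowed : Fin (suc k′) → Colouring (nV G) (suc k′) → Bool) (e : ℕ)
    (allowed-cong   : ∀ j {f f′} → f ≗ f′ → allowed j f ≡ allowed j f′)
    (allowed-needed : ∀ j f → isOnto (j ◃ f) ≡ true → isOnto f ≡ false → allowed j f ≡ true)
    (allowed-count  : ∀ f → sumBy (λ j → iverson (allowed j f)) (allFin (suc k′)) ≡ e) where

    open MissingColour G using (missesOnly; count-missesOnly)

    extendsAllowed : Colouring (suc (nV G)) (suc k′) → Bool
    extendsAllowed c = (allowed (c zero) (c ∘ suc) ∧ isProper G (c ∘ suc)) ∧ isOnto c

    private
      colours = allFin (suc k′)
      fs      = allMaps (nV G) (suc k′)

      properOnto : Colouring (nV G) (suc k′) → Bool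
      properOnto f = isProper G f ∧ isOnto f

      extensions-of-onto : ∀ f → isOnto f ≡ true →
        sumBy (λ j → iverson (extendsAllowed (j ◃ f))) colours ≡ e * iverson (properOnto f)
      extensions-of-onto f onto = begin
        sumBy (λ j → iverson (extendsAllowed (j ◃ f))) colours
          ≡⟨ sumBy-cong colours (λ j → cong iverson (trans (cong ((allowed j f ∧ isProper G f) ∧_) (isOnto-◃ j f onto))
                                                            (∧-identityʳ _))) ⟩
        sumBy (λ j → iverson (allowed j f ∧ isProper G f)) colours
          ≡⟨ sumBy-cong colours (λ j → trans (iverson-∧ (allowed j f) _) (*-comm (iverson (allowed j f)) _)) ⟩
        sumBy (λ j → iverson (isProper G f) * iverson (allowed j f)) colours
          ≡⟨ sumBy-*ˡ (iverson (isProper G f)) _ colours ⟩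
        iverson (isProper G f) * sumBy (λ j → iverson (allowed j f)) colours
          ≡⟨ cong₂ _*_ (cong iverson (sym (trans (cong (isProper G f ∧_) onto) (∧-identityʳ _)))) (allowed-count f) ⟩
        iverson (properOnto f) * e
          ≡⟨ *-comm _ e ⟩
        e * iverson (properOnto f) ∎
        where open ≡-Reasoning

      extensions-of-non-onto : ∀ f → isOnto f ≡ false → ∀ j → extendsAllowed (j ◃ f) ≡ missesOnly j f
      extensions-of-non-onto f non-onto j with isOnto (j ◃ f) in onto◃
      ... | true  rewrite allowed-needed j f onto◃ non-onto | non-onto = cong (_∧ true) (sym (∧-identityʳ _))
      ... | false = trans (∧-zeroʳ _) (sym (∧-zeroʳ _))

      per-colouring : ∀ f → sumBy (λ j → iverson (extendsAllowed (j ◃ f))) colours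
                          ≡ e * iverson (properOnto f) + sumBy (λ j → iverson (missesOnly j f)) colours
      per-colouring f = by-onto (isOnto f) refl
        where
        misses = sumBy (λ j → iverson (missesOnly j f)) colours
        by-onto : ∀ b → isOnto f ≡ b → sumBy (λ j → iverson (extendsAllowed (j ◃ f))) colours
                                     ≡ e * iverson (properOnto f) + misses
        by-onto true  onto = trans (extensions-of-onto f onto)
          (sym (trans (cong (e * iverson (properOnto f) +_) (sumBy-zero colours none)) (+-identityʳ _)))
          where
          none : ∀ j → iverson (missesOnly j f) ≡ 0
          none j = trans (cong (λ x → iverson ((isProper G f ∧ not x) ∧ isOnto (j ◃ f))) onto)
                         (cong (λ x → iverson (x ∧ isOnto (j ◃ f))) (∧-zeroʳ (isProper G f)))
        by-onto false non-onto = trans (sumBy-cong colours (cong iverson ∘ extensions-of-non-onto f non-onto))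
          (sym (cong (_+ misses) (trans (cong (λ x → e * iverson (isProper G f ∧ x)) non-onto)
                                        (trans (cong (λ x → e * iverson x) (∧-zeroʳ (isProper G f))) (*-zeroʳ e)))))

    count-extendsAllowed : countTrue extendsAllowed (allMaps (suc (nV G)) (suc k′))
                         ≡ e * surjColourings G (suc k′) + suc k′ * surjColourings G k′
    count-extendsAllowed = begin
      countTrue extendsAllowed (allMaps (suc (nV G)) (suc k′))
        ≡⟨ countTrue≡sumBy extendsAllowed (allMaps (suc (nV G)) (suc k′)) ⟩
      sumBy (iverson ∘ extendsAllowed) (allMaps (suc (nV G)) (suc k′))
        ≡⟨ sumBy-allMaps-suc (iverson ∘ extendsAllowed) (cong iverson ∘ extendsAllowed-cong) ⟩
      sumBy (λ j → sumBy (λ f → iverson (extendsAllowed (j ◃ f))) fs) colours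
        ≡⟨ sumBy-swap (λ j f → iverson (extendsAllowed (j ◃ f))) colours fs ⟩
      sumBy (λ f → sumBy (λ j → iverson (extendsAllowed (j ◃ f))) colours) fs
        ≡⟨ sumBy-cong fs per-colouring ⟩
      sumBy (λ f → e * iverson (properOnto f) + sumBy (λ j → iverson (missesOnly j f)) colours) fs
        ≡⟨ sumBy-+ _ _ fs ⟩
      sumBy (λ f → e * iverson (properOnto f)) fs + sumBy (λ f → sumBy (λ j → iverson (missesOnly j f)) colours) fs
        ≡⟨ cong₂ _+_ (trans (sumBy-*ˡ e _ fs) (cong (e *_) (sym (countTrue≡sumBy properOnto fs))))
                     (sumBy-swap (λ f j → iverson (missesOnly j f)) fs colours) ⟩
      e * surjColourings G (suc k′) + sumBy (λ j → sumBy (λ f → iverson (missesOnly j f)) fs) colours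
        ≡⟨ cong (e * surjColourings G (suc k′) +_)
                (sumBy-cong colours λ j → trans (sym (countTrue≡sumBy _ fs)) (count-missesOnly j)) ⟩
      e * surjColourings G (suc k′) + sumBy (λ _ → surjColourings G k′) colours
        ≡⟨ cong (e * surjColourings G (suc k′) +_) (sumBy-allFin-const (suc k′) (surjColourings G k′)) ⟩
      e * surjColourings G (suc k′) + suc k′ * surjColourings G k′ ∎
      where
      open ≡-Reasoning
      extendsAllowed-cong : ∀ {c c′} → c ≗ c′ → extendsAllowed c ≡ extendsAllowed c′
      extendsAllowed-cong {c} {c′} c≗c′ =
        cong₂ _∧_ (cong₂ _∧_ (trans (cong (λ x → allowed x (c ∘ suc)) (c≗c′ zero)) (allowed-cong (c′ zero) (c≗c′ ∘ suc)))
                             (isProper-cong G (c≗c′ ∘ suc)))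
                  (isOnto-cong c≗c′)

  surjColourings-isolated : ∀ n k′ →
    surjColourings (graph (suc n) []) (suc k′)
      ≡ suc k′ * surjColourings (graph n []) (suc k′) + suc k′ * surjColourings (graph n []) k′
  surjColourings-isolated n k′ =
    NewVertex.count-extendsAllowed (graph n []) (λ _ _ → true) (suc k′) (λ _ _ → refl) (λ _ _ _ _ → refl)
      (λ _ → trans (sumBy-allFin-const (suc k′) 1) (*-identityʳ (suc k′)))

  addPendant : (G : Graph) → Fin (nV G) → Graph
  addPendant G b = graph (suc (nV G)) ((fromℕ (nV G) , inject₁ b) ∷ map (λ (u , v) → inject₁ u , inject₁ v) (edges G))

  frontToBack : ∀ {n} → Fin (suc n) → Fin (suc n)
  frontToBack {n} zero    = fromℕ n
  frontToBack     (suc i) = inject₁ i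

  backToFront : ∀ {n} → Fin (suc n) → Fin (suc n)
  backToFront {zero}  zero    = zero
  backToFront {suc n} zero    = suc zero
  backToFront {suc n} (suc v) = Data.Fin.lift 1 suc (backToFront v)

  backToFront-fromℕ : ∀ n → backToFront (fromℕ n) ≡ zero
  backToFront-fromℕ zero    = refl
  backToFront-fromℕ (suc n) = cong (Data.Fin.lift 1 suc) (backToFront-fromℕ n)

  backToFront-inject₁ : ∀ {n} (i : Fin n) → backToFront (inject₁ i) ≡ suc i
  backToFront-inject₁ {suc n} zero    = refl
  backToFront-inject₁ {suc n} (suc i) = cong (Data.Fin.lift 1 suc) (backToFront-inject₁ i)

  backToFront-frontToBack : ∀ {n} (i : Fin (suc n)) → backToFront (frontToBack i) ≡ i
  backToFront-frontToBack {n} zero = backToFront-fromℕ n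
  backToFront-frontToBack (suc i)  = backToFront-inject₁ i

  frontToBack-backToFront : ∀ {n} (v : Fin (suc n)) → frontToBack (backToFront v) ≡ v
  frontToBack-backToFront {zero}  zero    = refl
  frontToBack-backToFront {suc n} zero    = refl
  frontToBack-backToFront {suc n} (suc v) with backToFront v | frontToBack-backToFront v
  ... | zero  | eq = cong suc eq
  ... | suc _ | eq = cong suc eq

  -- Once the pendant vertex is moved to the front, its allowed colours are those other than the
  -- colour of b; if it carries the only occurrence of its colour, that colour differs from b's.
  surjColourings-pendant : ∀ G (b : Fin (nV G)) k′ →
    surjColourings (addPendant G b) (suc k′) ≡ k′ * surjColourings G (suc k′) + suc k′ * surjColourings G k′
  surjColourings-pendant G b k′ = trans (countTrue-correspondence rotation) count-extendsAllowed
    where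
    n = nV G
    allowed : Fin (suc k′) → Colouring n (suc k′) → Bool
    allowed j f = not (j == f b)
    needed : ∀ j f → isOnto (j ◃ f) ≡ true → isOnto f ≡ false → allowed j f ≡ true
    needed j f onto non-onto with j Fin.≟ f b
    ... | yes j≡fb with () ← trans (sym (isOnto-◃⁻ j f onto (b , sym j≡fb))) non-onto
    ... | no  _    = refl
    open NewVertex G allowed k′ (λ j f≗f′ → cong (λ x → not (j == x)) (f≗f′ b)) needed (λ f → count-allFin-≢ (f b))
    rotation : Correspondence (λ c → isProper (addPendant G b) c ∧ isOnto c) extendsAllowed
    rotation = record
      { ψ           = _∘ backToFront
      ; p-cong      = λ c≗c′ → cong₂ _∧_ (isProper-cong (addPendant G b) c≗c′) (isOnto-cong c≗c′)
      ; ψ-cong      = λ d≗d′ → d≗d′ ∘ backToFront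
      ; ψ-injective = λ {d} {d′} dσ≗d′σ i →
          trans (cong d (sym (backToFront-frontToBack i))) (trans (dσ≗d′σ (frontToBack i)) (cong d′ (backToFront-frontToBack i)))
      ; p∘ψ≡q       = λ d → cong₂ _∧_
          (cong₂ _∧_ (cong not (cong₂ _==_ (cong d (backToFront-fromℕ n)) (cong d (backToFront-inject₁ b))))
                     (trans (all-map _ _ (edges G))
                            (all-cong (edges G) λ (u , v) →
                               cong not (cong₂ _==_ (cong d (backToFront-inject₁ u)) (cong d (backToFront-inject₁ v))))))
          (isOnto-∘ backToFront (λ i → frontToBack i , backToFront-frontToBack i) d)
      ; ψ-onto      = λ c _ → c ∘ frontToBack , λ v → cong c (frontToBack-backToFront v)
      }

  surjColourings-vanish : ∀ G k → nV G < k → surjColourings G k ≡ 0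
  surjColourings-vanish G k n<k = countTrue-none (allMaps (nV G) k) not-onto
    where
    no-surjection : ∀ c → isOnto c ≢ true
    no-surjection c onto with Fin.pigeonhole n<k (proj₁ ∘ isOnto⇒surjective c onto)
    ... | i , j , i<j , same-preimage = Fin.<⇒≢ i<j (begin
      i                                      ≡⟨ proj₂ (isOnto⇒surjective c onto i) ⟨
      c (proj₁ (isOnto⇒surjective c onto i)) ≡⟨ cong c same-preimage ⟩
      c (proj₁ (isOnto⇒surjective c onto j)) ≡⟨ proj₂ (isOnto⇒surjective c onto j) ⟩
      j                                      ∎)
      where open ≡-Reasoning
    not-onto : ∀ c → isProper G c ∧ isOnto c ≡ false
    not-onto c with isOnto c in onto
    ... | true  = ⊥-elim (no-surjection c onto)
    ... | false = ∧-zeroʳ _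

  factorial-∣-isolated : ∀ n k → k ! ∣ surjColourings (graph n []) k
  factorial-∣-isolated n       zero     = 1∣ _
  factorial-∣-isolated zero    (suc k′) = subst (suc k′ ! ∣_) (sym (surjColourings-vanish (graph 0 []) (suc k′) (s≤s z≤n))) (_ ∣0)
  factorial-∣-isolated (suc n) (suc k′) = subst (suc k′ ! ∣_) (sym (surjColourings-isolated n k′))
    (∣m∣n⇒∣m+n (∣-trans (factorial-∣-isolated n (suc k′)) (n∣m*n (suc k′))) (*-monoʳ-∣ (suc k′) (factorial-∣-isolated n k′)))

  contractAt-elim : ∀ (P : Graph → Set) n (a b : Fin (suc n)) es →
    P (graph (suc n) es) → (∀ es′ → P (graph n es′)) → P (contractAt (suc n) a b es)
  contractAt-elim P n a b es loop merged with a Fin.≟ b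
  ... | yes _ = loop
  ... | no  _ = merged _

  factorial-∣ : ∀ n es k → k ! ∣ surjColourings (graph n es) k
  factorial-∣ n       []             k = factorial-∣-isolated n k
  factorial-∣ (suc n) ((a , b) ∷ es) k = ∣m+n∣m⇒∣n
    (subst (k ! ∣_) (trans (surjColourings-deletion-contraction n a b es k) (+-comm (surjColourings G k) _))
           (factorial-∣ (suc n) es k))
    (contractAt-elim (λ H → k ! ∣ surjColourings H k) n a b es (factorial-∣ (suc n) es k) (λ es′ → factorial-∣ n es′ k))
    where G = graph (suc n) ((a , b) ∷ es)

  surjColourings≡partitionsInto*! : ∀ G k → surjColourings G k ≡ partitionsInto G k * k !
  surjColourings≡partitionsInto*! G k = sym (m/n*n≡m {{k !≢0}} (factorial-∣ (nV G) (edges G) k))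

  private
    cancel-! : ∀ k {x y} → x * k ! ≡ y * k ! → x ≡ y
    cancel-! k {x} {y} = *-cancelʳ-≡ x y (k !) {{k !≢0}}

  partitionsInto-vanish : ∀ G k → nV G < k → partitionsInto G k ≡ 0
  partitionsInto-vanish G k n<k =
    cancel-! k (trans (sym (surjColourings≡partitionsInto*! G k)) (surjColourings-vanish G k n<k))

  partitionsInto-deletion-contraction : ∀ n (a b : Fin (suc n)) es k →
    partitionsInto (graph (suc n) es) k
      ≡ partitionsInto (graph (suc n) ((a , b) ∷ es)) k + partitionsInto (contractAt (suc n) a b es) k
  partitionsInto-deletion-contraction n a b es k = cancel-! k (begin
    partitionsInto G-e k * k !                               ≡⟨ surjColourings≡partitionsInto*! G-e k ⟨
    surjColourings G-e k                                     ≡⟨ surjColourings-deletion-contraction n a b es k ⟩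
    surjColourings G k + surjColourings G/e k                ≡⟨ cong₂ _+_ (surjColourings≡partitionsInto*! G k)
                                                                           (surjColourings≡partitionsInto*! G/e k) ⟩
    partitionsInto G k * k ! + partitionsInto G/e k * k !    ≡⟨ *-distribʳ-+ (k !) (partitionsInto G k) _ ⟨
    (partitionsInto G k + partitionsInto G/e k) * k !        ∎)
    where
    open ≡-Reasoning
    G-e = graph (suc n) es
    G   = graph (suc n) ((a , b) ∷ es)
    G/e = contractAt (suc n) a b es

  partitionsInto-pendant : ∀ G (b : Fin (nV G)) k′ →
    partitionsInto (addPendant G b) (suc k′) ≡ k′ * partitionsInto G (suc k′) + partitionsInto G k′
  partitionsInto-pendant G b k′ = cancel-! (suc k′) (begin
    partitionsInto (addPendant G b) (suc k′) * suc k′ !    ≡⟨ surjColourings≡partitionsInto*! (addPendant G b) (suc k′) ⟨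
    surjColourings (addPendant G b) (suc k′)               ≡⟨ surjColourings-pendant G b k′ ⟩
    k′ * surjColourings G (suc k′) + suc k′ * surjColourings G k′
      ≡⟨ cong₂ (λ x y → k′ * x + suc k′ * y) (surjColourings≡partitionsInto*! G (suc k′)) (surjColourings≡partitionsInto*! G k′) ⟩
    k′ * (partitionsInto G (suc k′) * suc k′ !) + suc k′ * (partitionsInto G k′ * k′ !)
      ≡⟨ regroup k′ (partitionsInto G (suc k′)) (partitionsInto G k′) (k′ !) ⟩
    (k′ * partitionsInto G (suc k′) + partitionsInto G k′) * suc k′ ! ∎)
    where
    open ≡-Reasoning
    regroup : ∀ k y z f → k * (y * (suc k * f)) + suc k * (z * f) ≡ (k * y + z) * (suc k * f)
    regroup = solve-∀

  punchIn-fromℕ : ∀ {n} (i : Fin n) → punchIn (fromℕ n) i ≡ inject₁ i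
  punchIn-fromℕ {suc n} zero    = refl
  punchIn-fromℕ {suc n} (suc i) = cong suc (punchIn-fromℕ i)

  -- Undoing a subdivision: deleting a–w from G with a–b subdivided by w leaves addPendant G b,
  -- and contracting a–w gives G back.
  contract-subdivision : ∀ G (a b : Fin (nV G)) →
    contractAt (suc (nV G)) (inject₁ a) (fromℕ (nV G)) (edges (addPendant G b)) ≡ graph (nV G) ((a , b) ∷ edges G)
  contract-subdivision G a b with inject₁ a Fin.≟ fromℕ (nV G)
  ... | yes a≡w = ⊥-elim (Fin.fromℕ≢inject₁ (sym a≡w))
  ... | no  a≢w = cong (graph (nV G)) (cong₂ _∷_ (cong₂ _,_ μw≡a (μ-inject₁ b)) (μ-inject₁-edges (edges G)))
    where
    open Identification (inject₁ a) (fromℕ (nV G)) a≢w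
    μ-inject₁ : ∀ x → μ (inject₁ x) ≡ x
    μ-inject₁ x = trans (cong μ (sym (punchIn-fromℕ x))) (merge-punchIn x)
    μw≡a : μ (fromℕ (nV G)) ≡ a
    μw≡a = trans (sym merge-a≡merge-b) (μ-inject₁ a)
    μ-inject₁-edges : ∀ es → map (λ (u , v) → μ u , μ v) (map (λ (u , v) → inject₁ u , inject₁ v) es) ≡ es
    μ-inject₁-edges []             = refl
    μ-inject₁-edges ((u , v) ∷ es) = cong₂ _∷_ (cong₂ _,_ (μ-inject₁ u) (μ-inject₁ v)) (μ-inject₁-edges es)

module ChromaticPolynomial {c ℓ} (F : Field c ℓ) where

  open import Data.Nat as ℕ using (ℕ; zero; suc; _≤_; s≤s)
  import Data.Nat.Properties as ℕ
  open import Data.Fin using (Fin; inject₁; fromℕ)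
  open import Data.List using (_∷_; lookup; removeAt)
  open import Data.Product using (Σ; _,_; proj₁; proj₂)
  open import Data.Sum using (inj₁; inj₂)
  open import Function using (_∘_)
  open import Relation.Binary.PropositionalEquality as ≡ using (_≡_)
  open Field F
  open import Relation.Binary.Reasoning.Setoid setoid
  open import Algebra.Properties.CommutativeSemigroup +-commutativeSemigroup using (interchange)
  open DifferenceSolver commutativeRing using (ι; ι-homo-+; ι-homo-*; ι-suc; solve; _:=_; _:+_; _:*_; _:-_; :-_; con; :1)
  open SurjectiveColourings using (addPendant; contractAt-elim; contract-subdivision)
  open SurjectiveColourings using (partitionsInto-vanish; partitionsInto-deletion-contraction; partitionsInto-pendant)

  ℕ→F≈ι : ∀ n → ℕ→F F n ≈ ι n
  ℕ→F≈ι zero    = refl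
  ℕ→F≈ι (suc n) = trans (+-congˡ (ℕ→F≈ι n)) (sym (ι-suc n))

  ℕ→F-homo-+ : ∀ m n → ℕ→F F (m ℕ.+ n) ≈ ℕ→F F m + ℕ→F F n
  ℕ→F-homo-+ m n = trans (ℕ→F≈ι (m ℕ.+ n)) (trans (ι-homo-+ m n) (sym (+-cong (ℕ→F≈ι m) (ℕ→F≈ι n))))

  ℕ→F-homo-* : ∀ m n → ℕ→F F (m ℕ.* n) ≈ ℕ→F F m * ℕ→F F n
  ℕ→F-homo-* m n = trans (ℕ→F≈ι (m ℕ.* n)) (trans (ι-homo-* m n) (sym (*-cong (ℕ→F≈ι m) (ℕ→F≈ι n))))

  sumTo-cong : ∀ N {f g : ℕ → Carrier} → (∀ k → f k ≈ g k) → sumTo F N f ≈ sumTo F N g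
  sumTo-cong zero    f≈g = f≈g 0
  sumTo-cong (suc N) f≈g = +-cong (sumTo-cong N f≈g) (f≈g (suc N))

  sumTo-+ : ∀ N (f g : ℕ → Carrier) → sumTo F N (λ k → f k + g k) ≈ sumTo F N f + sumTo F N g
  sumTo-+ zero    f g = refl
  sumTo-+ (suc N) f g = trans (+-congʳ (sumTo-+ N f g)) (interchange _ _ _ _)

  chromaticTerm : Graph → Carrier → ℕ → Carrier
  chromaticTerm H x k = ℕ→F F (partitionsInto H k) * falling F x k

  chromatic-sumTo : ∀ H x N → nV H ≤ N → sumTo F N (chromaticTerm H x) ≈ chromatic F H x
  chromatic-sumTo H x N n≤N with ℕ.m≤n⇒m<n∨m≡n n≤N
  ... | inj₂ ≡.refl = refl
  chromatic-sumTo H x (suc N) n≤N | inj₁ (s≤s n≤N′) =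
    trans (+-cong (chromatic-sumTo H x N n≤N′) vanishes) (+-identityʳ _)
    where
    vanishes : chromaticTerm H x (suc N) ≈ 0#
    vanishes = trans (*-congʳ (reflexive (≡.cong (ℕ→F F) (partitionsInto-vanish H (suc N) (s≤s n≤N′))))) (zeroˡ _)

  chromatic-deletion-contraction : ∀ G (a b : Fin (nV G)) x →
    chromatic F G x ≈ chromatic F (graph (nV G) ((a , b) ∷ edges G)) x + chromatic F (contractAt (nV G) a b (edges G)) x
  chromatic-deletion-contraction (graph zero    es) () b x
  chromatic-deletion-contraction (graph (suc n) es) a  b x = begin
    sumTo F (suc n) (chromaticTerm G-e x)
      ≈⟨ sumTo-cong (suc n) split ⟩
    sumTo F (suc n) (λ k → chromaticTerm G x k + chromaticTerm G/e x k)
      ≈⟨ sumTo-+ (suc n) _ _ ⟩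
    sumTo F (suc n) (chromaticTerm G x) + sumTo F (suc n) (chromaticTerm G/e x)
      ≈⟨ +-congˡ (chromatic-sumTo G/e x (suc n) (contractAt-elim (λ H → nV H ≤ suc n) n a b es ℕ.≤-refl (λ _ → ℕ.n≤1+n n))) ⟩
    chromatic F G x + chromatic F G/e x ∎
    where
    G-e = graph (suc n) es
    G   = graph (suc n) ((a , b) ∷ es)
    G/e = contractAt (suc n) a b es
    split : ∀ k → chromaticTerm G-e x k ≈ chromaticTerm G x k + chromaticTerm G/e x k
    split k = trans (*-congʳ (trans (reflexive (≡.cong (ℕ→F F) (partitionsInto-deletion-contraction n a b es k)))
                                    (ℕ→F-homo-+ (partitionsInto G k) _)))
                    (distribʳ _ _ _)

  -- Since (x)ₖ₊₁ = (x)ₖ (x − k), the recurrence c (k + 1) = k b (k + 1) + b k telescopes.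
  falling-telescope : ∀ x (b c : ℕ → Carrier) → b 0 ≈ 0# → c 0 ≈ 0# → (∀ k → c (suc k) ≈ ℕ→F F k * b (suc k) + b k) →
    ∀ N → sumTo F (suc N) (λ k → c k * falling F x k)
          ≈ (x - 1#) * sumTo F N (λ k → b k * falling F x k) + ℕ→F F N * b (suc N) * falling F x (suc N)
  falling-telescope x b c b₀≈0 c₀≈0 c-rec zero = begin
    c 0 * 1# + c 1 * falling F x 1
      ≈⟨ +-cong (*-congʳ c₀≈0) (*-congʳ (trans (c-rec 0) (+-congˡ b₀≈0))) ⟩
    0# * 1# + (0# * b 1 + 0#) * falling F x 1
      ≈⟨ solve 3 (λ x b₁ f₁ → con (0 , 0) :* :1 :+ (con (0 , 0) :* b₁ :+ con (0 , 0)) :* f₁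
                             := (x :- :1) :* (con (0 , 0) :* :1) :+ con (0 , 0) :* b₁ :* f₁) refl x (b 1) (falling F x 1) ⟩
    (x - 1#) * (0# * 1#) + 0# * b 1 * falling F x 1
      ≈⟨ +-congʳ (*-congˡ (*-congʳ (sym b₀≈0))) ⟩
    (x - 1#) * (b 0 * 1#) + 0# * b 1 * falling F x 1 ∎
  falling-telescope x b c b₀≈0 c₀≈0 c-rec (suc N) = begin
    sumTo F (suc N) (λ k → c k * falling F x k) + c (suc (suc N)) * falling F x (suc (suc N))
      ≈⟨ +-cong (falling-telescope x b c b₀≈0 c₀≈0 c-rec N) (*-congʳ (c-rec (suc N))) ⟩
    ((x - 1#) * Σb + ℕ→F F N * b₁ * f₁) + (ℕ→F F (suc N) * b₂ + b₁) * (f₁ * (x - ℕ→F F (suc N)))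
      ≈⟨ solve 6 (λ x Σb n b₁ b₂ f₁ →
           ((x :- :1) :* Σb :+ n :* b₁ :* f₁) :+ ((:1 :+ n) :* b₂ :+ b₁) :* (f₁ :* (x :- (:1 :+ n)))
           := (x :- :1) :* (Σb :+ b₁ :* f₁) :+ (:1 :+ n) :* b₂ :* (f₁ :* (x :- (:1 :+ n))))
           refl x Σb (ℕ→F F N) b₁ b₂ f₁ ⟩
    (x - 1#) * (Σb + b₁ * f₁) + ℕ→F F (suc N) * b₂ * falling F x (suc (suc N)) ∎
    where
    Σb = sumTo F N (λ k → b k * falling F x k)
    b₁ = b (suc N)
    b₂ = b (suc (suc N))
    f₁ = falling F x (suc N)

  chromatic-pendant : ∀ G (b : Fin (nV G)) x → chromatic F (addPendant G b) x ≈ (x - 1#) * chromatic F G x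
  chromatic-pendant (graph zero    es) () x
  chromatic-pendant (graph (suc n) es) b  x = begin
    sumTo F (suc (suc n)) (chromaticTerm G′ x)
      ≈⟨ falling-telescope x (coefficient G) (coefficient G′) refl refl recurrence (suc n) ⟩
    (x - 1#) * sumTo F (suc n) (chromaticTerm G x) + ℕ→F F (suc n) * coefficient G (suc (suc n)) * falling F x (suc (suc n))
      ≈⟨ +-congˡ (trans (*-congʳ (trans (*-congˡ top-vanishes) (zeroʳ _))) (zeroˡ _)) ⟩
    (x - 1#) * chromatic F G x + 0#
      ≈⟨ +-identityʳ _ ⟩
    (x - 1#) * chromatic F G x ∎
    where
    G  = graph (suc n) es
    G′ = addPendant G b
    coefficient : Graph → ℕ → Carrier
    coefficient H k = ℕ→F F (partitionsInto H k)
    top-vanishes : coefficient G (suc (suc n)) ≈ 0#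
    top-vanishes = reflexive (≡.cong (ℕ→F F) (partitionsInto-vanish G (suc (suc n)) (ℕ.n<1+n (suc n))))
    recurrence : ∀ k → coefficient G′ (suc k) ≈ ℕ→F F k * coefficient G (suc k) + coefficient G k
    recurrence k = trans (reflexive (≡.cong (ℕ→F F) (partitionsInto-pendant G b k)))
                         (trans (ℕ→F-homo-+ (k ℕ.* partitionsInto G (suc k)) _) (+-congʳ (ℕ→F-homo-* k _)))

  module Subdivision (q : Carrier) where

    D C : Σ Graph Edge → Carrier
    D p = proj₂ (w F q p)
    C p = proj₁ (w F q p)

    deletion-subdivide : ∀ p → D (S p) ≈ (q - 1#) * D p
    deletion-subdivide (G , e) = chromatic-pendant (G -ₑ e) (proj₂ (lookup (edges G) e)) q

    contraction-subdivide : ∀ p → C (S p) ≈ D p - C p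
    contraction-subdivide (G , e) = begin
      chromatic F (contractAt (suc (nV G)) (inject₁ a) (fromℕ (nV G)) (edges (addPendant (G -ₑ e) b))) q
        ≡⟨ ≡.cong (λ H → chromatic F H q) (contract-subdivision (G -ₑ e) a b) ⟩
      chromatic F G′ q
        ≈⟨ solve 2 (λ y z → y := (y :+ z) :- z) refl (chromatic F G′ q) (chromatic F (G /ₑ e) q) ⟩
      (chromatic F G′ q + chromatic F (G /ₑ e) q) - chromatic F (G /ₑ e) q
        ≈⟨ +-congʳ (chromatic-deletion-contraction (G -ₑ e) a b q) ⟨
      chromatic F (G -ₑ e) q - chromatic F (G /ₑ e) q ∎
      where
      a  = proj₁ (lookup (edges G) e)
      b  = proj₂ (lookup (edges G) e)
      G′ = graph (nV G) ((a , b) ∷ removeAt (edges G) e)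

    invariant-subdivide : ∀ p → q * C (S p) - D (S p) ≈ D p - q * C p
    invariant-subdivide p = trans (+-cong (*-congˡ (contraction-subdivide p)) (-‿cong (deletion-subdivide p)))
      (solve 3 (λ q c d → q :* (d :- c) :- (q :- :1) :* d := d :- q :* c) refl q (C p) (D p))

    deletion-iterate : ∀ j p → D (iterate S j p) ≈ pow F (q - 1#) j * D p
    deletion-iterate zero    p = sym (*-identityˡ _)
    deletion-iterate (suc j) p =
      trans (deletion-subdivide (iterate S j p)) (trans (*-congˡ (deletion-iterate j p)) (sym (*-assoc _ _ _)))

    invariant-iterate-even : ∀ m p → q * C (iterate S (2 ℕ.* m) p) - D (iterate S (2 ℕ.* m) p) ≈ q * C p - D p
    invariant-iterate-even zero    p = refl
    invariant-iterate-even (suc m) p = begin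
      q * C (iterate S (2 ℕ.* suc m) p) - D (iterate S (2 ℕ.* suc m) p)
        ≡⟨ ≡.cong (λ p′ → q * C p′ - D p′) (≡.cong (λ j → iterate S j p) (ℕ.*-suc 2 m)) ⟩
      q * C (S (S pₘ)) - D (S (S pₘ))   ≈⟨ invariant-subdivide (S pₘ) ⟩
      D (S pₘ) - q * C (S pₘ)           ≈⟨ swap-diff (invariant-subdivide pₘ) ⟩
      q * C pₘ - D pₘ                   ≈⟨ invariant-iterate-even m p ⟩
      q * C p - D p                     ∎
      where
      pₘ = iterate S (2 ℕ.* m) p
      swap-diff : ∀ {x y u v} → x - y ≈ u - v → y - x ≈ v - u
      swap-diff {x} {y} {u} {v} eq = begin
        y - x       ≈⟨ solve 2 (λ x y → y :- x := :- (x :- y)) refl x y ⟩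
        - (x - y)   ≈⟨ -‿cong eq ⟩
        - (u - v)   ≈⟨ solve 2 (λ u v → :- (u :- v) := v :- u) refl u v ⟩
        v - u       ∎

lemma5p2 : ∀ {c ℓ} (F : Field c ℓ) → let open Field F in
    (m : ℕ) → 1 ≤ m →
    (q : Carrier) → ¬ (q ≈ 1#) → ¬ (q ≈ 0#) →
    (G : Graph) → Planar G → (e : Edge G) →
    ¬ (chromatic F (G -ₑ e) q ≈ 0#) →
    (¬ (proj₂ (w F q (iterate S (2 *ℕ m) (G , e))) ≈ 0#))
    × (r F (w F q (iterate S (2 *ℕ m) (G , e)))
    ≈ (q ⁻¹) + ((r F (w F q (G , e)) - (q ⁻¹)) * (pow F (q - 1#) (2 *ℕ m) ⁻¹)))
lemma5p2 F m _ q q≉1 q≉0 G _ e D≉0 =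
  (λ Dₘ≈0 → *-nonzero A≉0 D≉0 (trans (sym Dₘ≈AD) Dₘ≈0)) ,
  ratio-shift q≉0 A≉0 D≉0 Dₘ≈AD (invariant-iterate-even m (G , e))
  where
  open Field F
  open FieldProperties F
  open ChromaticPolynomial F
  open Subdivision q
  A≉0 : ¬ pow F (q - 1#) (2 *ℕ m) ≈ 0#
  A≉0 = pow-nonzero (x≉y⇒x-y≉0 q≉1) (2 *ℕ m)
  Dₘ≈AD : D (iterate S (2 *ℕ m) (G , e)) ≈ pow F (q - 1#) (2 *ℕ m) * D (G , e)
  Dₘ≈AD = deletion-iterate (2 *ℕ m) (G , e)
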